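{- Let $G$ be a finite transitive permutation group whose point stabilizers have order $2$. Then $G$ has the EKR property if (i) $G$ has a cyclic Sylow $2$-subgroup, or (ii) $G$ is a nilpotent group.
   Context: For $G\le\mathrm{Sym}(V)$, a subset $\mathcal{F}\subseteq G$ is intersecting if for any $g,h\in\mathcal{F}$ there is $v\in V$ with $g(v)=h(v)$. $G$ has the Erdős–Ko–Rado (EKR) property if the maximum size of an intersecting set of $G$ equals the maximum order of a point stabilizer $G_v$, $v\in V$. -}

module Defs where

open import Data.Nat using (ℕ; zero; suc; _≤_; _^_; _⊔_)
open import Data.Nat.Divisibility using (_∣_)
open import Data.Fin using (Fin)
open import Data.Fin.Properties using () renaming (_≟_ to _≟ᶠ_)
open import Data.Vec using (Vec; lookup; tabulate)
open import Data.List using (List; length; filter; map; foldr; allFin)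
open import Data.List.Membership.Propositional using (_∈_)
open import Data.List.Relation.Unary.All using (All)
open import Data.List.Relation.Unary.Unique.Propositional using (Unique)
open import Data.Product using (Σ; ∃; _×_)
open import Relation.Binary.PropositionalEquality using (_≡_)
open import Relation.Nullary using (¬_)

-- A map V → V on V = Fin n, stored as its table of values (so that _≡_ is
-- extensional equality of maps).
Map : ℕ → Set
Map n = Vec (Fin n) n

_∘ₚ_ : ∀ {n} → Map n → Map n → Map n
g ∘ₚ h = tabulate (λ v → lookup g (lookup h v))

idₚ : ∀ {n} → Map n
idₚ = tabulate (λ v → v)

_^ₚ_ : ∀ {n} → Map n → ℕ → Map n
g ^ₚ zero  = idₚ
g ^ₚ suc k = g ∘ₚ (g ^ₚ k)

-- A finite subgroup of Sym(Fin n), given by the duplicate-free list of its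
-- elements: contains the identity, closed under composition, and every element
-- has an inverse in the list (hence all elements are permutations).
record IsPermGroup {n : ℕ} (G : List (Map n)) : Set where
  field
    unique  : Unique G
    has-id  : idₚ ∈ G
    closed  : ∀ {g h} → g ∈ G → h ∈ G → (g ∘ₚ h) ∈ G
    inverse : ∀ {g} → g ∈ G → Σ (Map n) λ h → h ∈ G × (g ∘ₚ h ≡ idₚ)

∣_∣ᴳ : ∀ {n} → List (Map n) → ℕ
∣ G ∣ᴳ = length G

Transitive : ∀ {n} → List (Map n) → Set
Transitive {n} G = (v w : Fin n) → Σ (Map n) λ g → g ∈ G × (lookup g v ≡ w)

stab : ∀ {n} → List (Map n) → Fin n → List (Map n)
stab G v = filter (λ g → lookup g v ≟ᶠ v) G

maxStab : ∀ {n} → List (Map n) → ℕ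
maxStab {n} G = foldr _⊔_ 0 (map (λ v → length (stab G v)) (allFin n))

Intersecting : ∀ {n} → List (Map n) → List (Map n) → Set
Intersecting {n} G F =
  All (_∈ G) F × Unique F ×
  (∀ {g h} → g ∈ F → h ∈ F → Σ (Fin n) λ v → lookup g v ≡ lookup h v)

EKR : ∀ {n} → List (Map n) → Set
EKR G =
  (Σ _ λ F → Intersecting G F × length F ≡ maxStab G) ×
  (∀ F → Intersecting G F → length F ≤ maxStab G)

IsSubgroup : ∀ {n} → List (Map n) → List (Map n) → Set
IsSubgroup G P = All (_∈ G) P × IsPermGroup P

IsSylow2 : ∀ {n} → List (Map n) → List (Map n) → Set
IsSylow2 G P = IsSubgroup G P ×
  ∃ λ a → length P ≡ 2 ^ a × (2 ^ a) ∣ ∣ G ∣ᴳ × ¬ ((2 ^ suc a) ∣ ∣ G ∣ᴳ)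

IsCyclic : ∀ {n} → List (Map n) → Set
IsCyclic {n} P = Σ (Map n) λ g → g ∈ P × (∀ {h} → h ∈ P → ∃ λ k → g ^ₚ k ≡ h)

HasCyclicSylow2 : ∀ {n} → List (Map n) → Set
HasCyclicSylow2 G = Σ _ λ P → IsSylow2 G P × IsCyclic P

-- upper central series: Z₀ = 1,
-- Z_{i+1} = { g ∈ G : ∀ x ∈ G, [g,x] ∈ Z_i }, where [g,x] = g⁻¹x⁻¹gx ∈ Z_i
-- is written inverse-free as ∃ z ∈ Z_i with g x = x g z.
UpperCentral : ∀ {n} → List (Map n) → ℕ → Map n → Set
UpperCentral G zero    g = g ≡ idₚ
UpperCentral {n} G (suc i) g = g ∈ G ×
  (∀ {x} → x ∈ G → Σ (Map n) λ z → UpperCentral G i z × (g ∘ₚ x ≡ x ∘ₚ (g ∘ₚ z)))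

IsNilpotent : ∀ {n} → List (Map n) → Set
IsNilpotent G = ∃ λ c → All (UpperCentral G c) G

-- If every point stabilizer has order 2, a point stabilizer is an intersecting set of the
-- maximal stabilizer size 2, and it remains to exclude intersecting sets {f₁, f₂, f₃}. In such
-- a set a = f₁⁻¹f₂ and b = f₁⁻¹f₃ are non-identity elements fixing a point. A point stabilizer
-- has a single non-identity element, so such elements are involutions; hence ab = a⁻¹b = f₂⁻¹f₃
-- is another one, and {1, a, b, ab} is a Klein four-group. This is impossible when a Sylow
-- 2-subgroup P is cyclic: P has one involution, and a double coset count then shows that
-- 2|P| divides |G|, against the maximality of P.
-- It is also impossible in a nilpotent group: if a lies in Z_{i+1}, conjugating by an element x
-- that carries the fixed point of b to that of a gives x⁻¹ax = b, so the commutator [a, x] = ab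
-- lies in Z_i and forms such a triple with b; descending the upper central series reaches
-- a = 1.
module Submission where

open import Defs
open import Data.Nat using (ℕ; zero; suc; _+_; _≤_; _^_; _⊔_; z≤n; s≤s; _∸_; _≤?_)
open import Data.Nat.Properties
open import Data.Nat.Divisibility using (_∣_; ∣m∣n⇒∣m+n; ∣-refl; _∣0)
open import Data.List using (List; []; _∷_; length; filter; map; _++_; foldr; tabulate)
open import Data.List.Properties using (length-++; length-map; filter-all)
open import Data.List.Membership.Propositional using (_∈_; find; lose)
open import Data.List.Membership.Propositional.Properties
  using (∈-length; ∈-filter⁻; ∈-filter⁺; ∈-map⁺; ∈-map⁻; ∈-++⁺ˡ; ∈-++⁺ʳ; ∈-++⁻; ∈-∃++)
open import Data.List.Relation.Binary.Subset.Propositional using (_⊆_)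
open import Data.List.Relation.Unary.All as All using (All; []; _∷_)
open import Data.List.Relation.Unary.Any using (Any; here; there; any?)
open import Data.List.Relation.Unary.AllPairs using ([]; _∷_)
open import Data.List.Relation.Unary.Unique.Propositional using (Unique)
import Data.List.Relation.Unary.Unique.Propositional.Properties as Unique
open import Data.Vec using (lookup)
open import Data.Vec.Properties using (lookup∘tabulate; tabulate∘lookup; tabulate-cong; ≡-dec)
open import Data.Fin using (Fin) renaming (zero to fzero; suc to fsuc)
import Data.Fin as Fin
open import Data.Product using (Σ; ∃; _×_; _,_; proj₁; proj₂)
open import Data.Sum using (_⊎_; inj₁; inj₂; [_,_]′)
open import Function using (_∘_; id)
open import Data.Empty using (⊥; ⊥-elim)
open import Relation.Nullary using (¬_; Dec; yes; no)
open import Relation.Unary.Properties using (∁?)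
open import Relation.Binary.Definitions using (DecidableEquality)
open import Relation.Binary.PropositionalEquality

private variable
  n : ℕ
  a b c g h p q r u w x y : Map n

_≟ₘ_ : DecidableEquality (Map n)
_≟ₘ_ = ≡-dec Fin._≟_

lookup-∘ : (g h : Map n) (v : Fin n) → lookup (g ∘ₚ h) v ≡ lookup g (lookup h v)
lookup-∘ g h = lookup∘tabulate _

lookup-id : (v : Fin n) → lookup (idₚ {n}) v ≡ v
lookup-id = lookup∘tabulate _

lookup-ext : (∀ v → lookup g v ≡ lookup h v) → g ≡ h
lookup-ext {g = g} {h} g≗h =
  trans (sym (tabulate∘lookup g)) (trans (tabulate-cong g≗h) (tabulate∘lookup h))

∘-assoc : (g h k : Map n) → (g ∘ₚ h) ∘ₚ k ≡ g ∘ₚ (h ∘ₚ k)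
∘-assoc g h k = lookup-ext λ v → begin
  lookup ((g ∘ₚ h) ∘ₚ k) v          ≡⟨ lookup-∘ (g ∘ₚ h) k v ⟩
  lookup (g ∘ₚ h) (lookup k v)      ≡⟨ lookup-∘ g h (lookup k v) ⟩
  lookup g (lookup h (lookup k v))  ≡⟨ cong (lookup g) (lookup-∘ h k v) ⟨
  lookup g (lookup (h ∘ₚ k) v)      ≡⟨ lookup-∘ g (h ∘ₚ k) v ⟨
  lookup (g ∘ₚ (h ∘ₚ k)) v          ∎
  where open ≡-Reasoning

∘-identityˡ : (g : Map n) → idₚ ∘ₚ g ≡ g
∘-identityˡ g = lookup-ext λ v → trans (lookup-∘ idₚ g v) (lookup-id _)

∘-identityʳ : (g : Map n) → g ∘ₚ idₚ ≡ g
∘-identityʳ g = lookup-ext λ v → trans (lookup-∘ g idₚ v) (cong (lookup g) (lookup-id v))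

involution-cancelˡ : c ∘ₚ c ≡ idₚ → ∀ x → c ∘ₚ (c ∘ₚ x) ≡ x
involution-cancelˡ {c = c} cc x = begin
  c ∘ₚ (c ∘ₚ x)  ≡⟨ ∘-assoc c c x ⟨
  (c ∘ₚ c) ∘ₚ x  ≡⟨ cong (_∘ₚ x) cc ⟩
  idₚ ∘ₚ x       ≡⟨ ∘-identityˡ x ⟩
  x              ∎
  where open ≡-Reasoning

involutions-commute : a ∘ₚ a ≡ idₚ → b ∘ₚ b ≡ idₚ → (a ∘ₚ b) ∘ₚ (a ∘ₚ b) ≡ idₚ →
                      b ∘ₚ a ≡ a ∘ₚ b
involutions-commute {a = a} {b} aa bb abab = begin
  b ∘ₚ a                               ≡⟨ ∘-identityˡ (b ∘ₚ a) ⟨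
  idₚ ∘ₚ (b ∘ₚ a)                      ≡⟨ cong (_∘ₚ (b ∘ₚ a)) abab ⟨
  ((a ∘ₚ b) ∘ₚ (a ∘ₚ b)) ∘ₚ (b ∘ₚ a)   ≡⟨ ∘-assoc (a ∘ₚ b) (a ∘ₚ b) (b ∘ₚ a) ⟩
  (a ∘ₚ b) ∘ₚ ((a ∘ₚ b) ∘ₚ (b ∘ₚ a))   ≡⟨ cong ((a ∘ₚ b) ∘ₚ_) ab∘ba ⟩
  (a ∘ₚ b) ∘ₚ idₚ                      ≡⟨ ∘-identityʳ (a ∘ₚ b) ⟩
  a ∘ₚ b                               ∎
  where
  open ≡-Reasoning
  ab∘ba : (a ∘ₚ b) ∘ₚ (b ∘ₚ a) ≡ idₚ
  ab∘ba = trans (∘-assoc a b (b ∘ₚ a)) (trans (cong (a ∘ₚ_) (involution-cancelˡ {c = b} bb a)) aa)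

^-distribˡ-+-∘ : (g : Map n) (i j : ℕ) → g ^ₚ (i + j) ≡ (g ^ₚ i) ∘ₚ (g ^ₚ j)
^-distribˡ-+-∘ g zero    j = sym (∘-identityˡ (g ^ₚ j))
^-distribˡ-+-∘ g (suc i) j =
  trans (cong (g ∘ₚ_) (^-distribˡ-+-∘ g i j)) (sym (∘-assoc g (g ^ₚ i) (g ^ₚ j)))

^-commute : (g : Map n) (i j : ℕ) → (g ^ₚ i) ∘ₚ (g ^ₚ j) ≡ (g ^ₚ j) ∘ₚ (g ^ₚ i)
^-commute g i j =
  trans (sym (^-distribˡ-+-∘ g i j)) (trans (cong (g ^ₚ_) (+-comm i j)) (^-distribˡ-+-∘ g j i))

DistinctInvolutions : Map n → Map n → Set
DistinctInvolutions u w = u ≢ idₚ × w ≢ idₚ × u ≢ w × u ∘ₚ u ≡ idₚ × w ∘ₚ w ≡ idₚ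

DistinctInvolutions-sym : DistinctInvolutions u w → DistinctInvolutions w u
DistinctInvolutions-sym (u≢1 , w≢1 , u≢w , uu , ww) = w≢1 , u≢1 , u≢w ∘ sym , ww , uu

DistinctInvolutions-∘ʳ : u ∘ₚ w ≡ w ∘ₚ u → DistinctInvolutions u (u ∘ₚ w) → DistinctInvolutions u w
DistinctInvolutions-∘ʳ {u = u} {w} uw≡wu (u≢1 , uw≢1 , u≢uw , uu , uwuw) = u≢1 , w≢1 , u≢w , uu , ww
  where
  open ≡-Reasoning
  w≢1 : w ≢ idₚ
  w≢1 w≡1 = u≢uw (sym (trans (cong (u ∘ₚ_) w≡1) (∘-identityʳ u)))
  u≢w : u ≢ w
  u≢w u≡w = uw≢1 (trans (cong (u ∘ₚ_) (sym u≡w)) uu)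
  ww : w ∘ₚ w ≡ idₚ
  ww = begin
    w ∘ₚ w                ≡⟨ involution-cancelˡ {c = u} uu (w ∘ₚ w) ⟨
    u ∘ₚ (u ∘ₚ (w ∘ₚ w))  ≡⟨ cong (u ∘ₚ_) (∘-assoc u w w) ⟨
    u ∘ₚ ((u ∘ₚ w) ∘ₚ w)  ≡⟨ cong (λ t → u ∘ₚ (t ∘ₚ w)) uw≡wu ⟩
    u ∘ₚ ((w ∘ₚ u) ∘ₚ w)  ≡⟨ cong (u ∘ₚ_) (∘-assoc w u w) ⟩
    u ∘ₚ (w ∘ₚ (u ∘ₚ w))  ≡⟨ ∘-assoc u w (u ∘ₚ w) ⟨
    (u ∘ₚ w) ∘ₚ (u ∘ₚ w)  ≡⟨ uwuw ⟩
    idₚ                   ∎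

-- Euclid's algorithm on the exponents: g^i and g^(j-i) are again distinct involutions.
no-distinct-involutive-powers : (g : Map n) (i j : ℕ) → ¬ DistinctInvolutions (g ^ₚ i) (g ^ₚ j)
no-distinct-involutive-powers g i j = go (i + j) i j ≤-refl
  where
  go : ∀ s i j → i + j ≤ s → ¬ DistinctInvolutions (g ^ₚ i) (g ^ₚ j)
  shrink : ∀ {s i j} → i ≤ j → suc i + suc j ≤ suc s →
           ¬ DistinctInvolutions (g ^ₚ suc i) (g ^ₚ suc j)
  go _       zero    _       _  (g⁰≢1 , _)     = g⁰≢1 refl
  go _       (suc i) zero    _  (_ , g⁰≢1 , _) = g⁰≢1 refl
  go (suc s) (suc i) (suc j) le d =
    [ (λ i≤j → shrink i≤j le d)
    , (λ j≤i → shrink j≤i (subst (_≤ suc s) (+-comm (suc i) (suc j)) le) (DistinctInvolutions-sym d))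
    ]′ (≤-total i j)
  shrink {s} {i} {j} i≤j le d = go s (suc i) (j ∸ i) bound
    (DistinctInvolutions-∘ʳ (^-commute g (suc i) (j ∸ i))
                            (subst (DistinctInvolutions (g ^ₚ suc i)) split d))
    where
    sum≡ : suc i + (j ∸ i) ≡ suc j
    sum≡ = cong suc (m+[n∸m]≡n i≤j)
    split : g ^ₚ suc j ≡ (g ^ₚ suc i) ∘ₚ (g ^ₚ (j ∸ i))
    split = trans (cong (g ^ₚ_) (sym sum≡)) (^-distribˡ-+-∘ g (suc i) (j ∸ i))
    bound : suc i + (j ∸ i) ≤ s
    bound = subst (_≤ s) (sym sum≡) (≤-trans (m≤n+m (suc j) i) (≤-pred le))

cyclic⇒¬DistinctInvolutions : ∀ {P : List (Map n)} → IsCyclic P → p ∈ P → q ∈ P →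
                              ¬ DistinctInvolutions p q
cyclic⇒¬DistinctInvolutions (g , _ , generates) p∈P q∈P
  with generates p∈P | generates q∈P
... | i , refl | j , refl = no-distinct-involutive-powers g i j

module PermGroupProperties {G : List (Map n)} (isG : IsPermGroup G) where
  open IsPermGroup isG
  open ≡-Reasoning

  inverse₂ : g ∈ G → Σ (Map n) λ h → h ∈ G × g ∘ₚ h ≡ idₚ × h ∘ₚ g ≡ idₚ
  inverse₂ {g} g∈G with inverse g∈G
  ... | h , h∈G , gh≡1 with inverse h∈G
  ... | h′ , _ , hh′≡1 = h , h∈G , gh≡1 , trans (cong (h ∘ₚ_) g≡h′) hh′≡1
    where
    g≡h′ : g ≡ h′
    g≡h′ = begin
      g                ≡⟨ ∘-identityʳ g ⟨
      g ∘ₚ idₚ         ≡⟨ cong (g ∘ₚ_) hh′≡1 ⟨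
      g ∘ₚ (h ∘ₚ h′)   ≡⟨ ∘-assoc g h h′ ⟨
      (g ∘ₚ h) ∘ₚ h′   ≡⟨ cong (_∘ₚ h′) gh≡1 ⟩
      idₚ ∘ₚ h′        ≡⟨ ∘-identityˡ h′ ⟩
      h′               ∎

  ∘-cancelˡ : g ∈ G → g ∘ₚ x ≡ g ∘ₚ y → x ≡ y
  ∘-cancelˡ {g} {x} {y} g∈G gx≡gy with inverse₂ g∈G
  ... | h , _ , _ , hg≡1 = begin
    x                ≡⟨ ∘-identityˡ x ⟨
    idₚ ∘ₚ x         ≡⟨ cong (_∘ₚ x) hg≡1 ⟨
    (h ∘ₚ g) ∘ₚ x    ≡⟨ ∘-assoc h g x ⟩
    h ∘ₚ (g ∘ₚ x)    ≡⟨ cong (h ∘ₚ_) gx≡gy ⟩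
    h ∘ₚ (g ∘ₚ y)    ≡⟨ ∘-assoc h g y ⟨
    (h ∘ₚ g) ∘ₚ y    ≡⟨ cong (_∘ₚ y) hg≡1 ⟩
    idₚ ∘ₚ y         ≡⟨ ∘-identityˡ y ⟩
    y                ∎

  ∘-cancelʳ : g ∈ G → x ∘ₚ g ≡ y ∘ₚ g → x ≡ y
  ∘-cancelʳ {g} {x} {y} g∈G xg≡yg with inverse₂ g∈G
  ... | h , _ , gh≡1 , _ = begin
    x                ≡⟨ ∘-identityʳ x ⟨
    x ∘ₚ idₚ         ≡⟨ cong (x ∘ₚ_) gh≡1 ⟨
    x ∘ₚ (g ∘ₚ h)    ≡⟨ ∘-assoc x g h ⟨
    (x ∘ₚ g) ∘ₚ h    ≡⟨ cong (_∘ₚ h) xg≡yg ⟩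
    (y ∘ₚ g) ∘ₚ h    ≡⟨ ∘-assoc y g h ⟩
    y ∘ₚ (g ∘ₚ h)    ≡⟨ cong (y ∘ₚ_) gh≡1 ⟩
    y ∘ₚ idₚ         ≡⟨ ∘-identityʳ y ⟩
    y                ∎

  lookup-injective : ∀ {u w} → g ∈ G → lookup g u ≡ lookup g w → u ≡ w
  lookup-injective {g} {u} {w} g∈G gu≡gw with inverse₂ g∈G
  ... | h , _ , _ , hg≡1 = begin
    u                      ≡⟨ lookup-id u ⟨
    lookup idₚ u           ≡⟨ cong (λ t → lookup t u) hg≡1 ⟨
    lookup (h ∘ₚ g) u      ≡⟨ lookup-∘ h g u ⟩
    lookup h (lookup g u)  ≡⟨ cong (lookup h) gu≡gw ⟩
    lookup h (lookup g w)  ≡⟨ lookup-∘ h g w ⟨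
    lookup (h ∘ₚ g) w      ≡⟨ cong (λ t → lookup t w) hg≡1 ⟩
    lookup idₚ w           ≡⟨ lookup-id w ⟩
    w                      ∎

  conjugate-involution : x ∈ G → c ∘ₚ c ≡ idₚ → c ∘ₚ x ≡ x ∘ₚ r → r ∘ₚ r ≡ idₚ
  conjugate-involution {x} {c} {r} x∈G cc cx≡xr = ∘-cancelˡ x∈G (begin
    x ∘ₚ (r ∘ₚ r)   ≡⟨ ∘-assoc x r r ⟨
    (x ∘ₚ r) ∘ₚ r   ≡⟨ cong (_∘ₚ r) cx≡xr ⟨
    (c ∘ₚ x) ∘ₚ r   ≡⟨ ∘-assoc c x r ⟩
    c ∘ₚ (x ∘ₚ r)   ≡⟨ cong (c ∘ₚ_) cx≡xr ⟨
    c ∘ₚ (c ∘ₚ x)   ≡⟨ involution-cancelˡ {c = c} cc x ⟩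
    x               ≡⟨ ∘-identityʳ x ⟨
    x ∘ₚ idₚ        ∎)

  conjugate-nonId : x ∈ G → c ≢ idₚ → c ∘ₚ x ≡ x ∘ₚ r → r ≢ idₚ
  conjugate-nonId {x} x∈G c≢1 cx≡xr refl =
    c≢1 (∘-cancelʳ x∈G (trans cx≡xr (trans (∘-identityʳ x) (sym (∘-identityˡ x)))))

module _ {A : Set} where

  Unique-⊆⇒length≤ : {xs ys : List A} → Unique xs → xs ⊆ ys → length xs ≤ length ys
  Unique-⊆⇒length≤ {[]}     _              _     = z≤n
  Unique-⊆⇒length≤ {x ∷ xs} (x∉xs ∷ !xs) xs⊆ys with ∈-∃++ (xs⊆ys (here refl))
  ... | us , vs , refl = subst (suc (length xs) ≤_) (sym length-us++x∷vs) (s≤s length-xs≤)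
    where
    length-us++x∷vs : length (us ++ x ∷ vs) ≡ suc (length (us ++ vs))
    length-us++x∷vs = begin
      length (us ++ x ∷ vs)        ≡⟨ length-++ us ⟩
      length us + suc (length vs)  ≡⟨ +-suc (length us) (length vs) ⟩
      suc (length us + length vs)  ≡⟨ cong suc (length-++ us) ⟨
      suc (length (us ++ vs))      ∎
      where open ≡-Reasoning
    xs⊆us++vs : xs ⊆ us ++ vs
    xs⊆us++vs {y} y∈xs with ∈-++⁻ us (xs⊆ys (there y∈xs))
    ... | inj₁ y∈us          = ∈-++⁺ˡ y∈us
    ... | inj₂ (here refl)   = ⊥-elim (All.lookup x∉xs y∈xs refl)
    ... | inj₂ (there y∈vs)  = ∈-++⁺ʳ us y∈vs
    length-xs≤ : length xs ≤ length (us ++ vs)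
    length-xs≤ = Unique-⊆⇒length≤ !xs xs⊆us++vs

  length-filter-∁ : {P : A → Set} (P? : ∀ x → Dec (P x)) (xs : List A) →
                    length xs ≡ length (filter P? xs) + length (filter (∁? P?) xs)
  length-filter-∁ P? []       = refl
  length-filter-∁ P? (x ∷ xs) with P? x
  ... | yes _ = cong suc (length-filter-∁ P? xs)
  ... | no  _ = trans (cong suc (length-filter-∁ P? xs)) (sym (+-suc _ _))

module OrbitCounting {X : Set} (_≟_ : DecidableEquality X) (orbit : X → List X)
  (Good : X → Set) (K : ℕ)
  (orbit-unique : ∀ {y} → Good y → Unique (orbit y))
  (length-orbit : ∀ y → length (orbit y) ≡ K)
  (orbit-refl   : ∀ {y} → y ∈ orbit y)
  (orbit-trans  : ∀ {y z w} → z ∈ orbit y → w ∈ orbit z → w ∈ orbit y)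
  (orbit-sym    : ∀ {y z} → z ∈ orbit y → y ∈ orbit z) where
  open import Data.List.Membership.DecPropositional _≟_ using (_∈?_)

  OrbitClosed : List X → Set
  OrbitClosed Y = ∀ {y z} → y ∈ Y → z ∈ orbit y → z ∈ Y

  orbit-size-∣-length : ∀ {Y} → Unique Y → All Good Y → OrbitClosed Y → K ∣ length Y
  orbit-size-∣-length {Y} = go (length Y) Y ≤-refl
    where
    go : ∀ fuel Y → length Y ≤ fuel → Unique Y → All Good Y → OrbitClosed Y → K ∣ length Y
    go _          []      _  _  _  _ = K ∣0
    go (suc fuel) (y ∷ Y) le !Y gY closed =
      subst (K ∣_) (sym (length-filter-∁ in-O? (y ∷ Y)))
            (∣m∣n⇒∣m+n (subst (K ∣_) (sym length-inside) ∣-refl) divides-outside)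
      where
      in-O? : ∀ x → Dec (x ∈ orbit y)
      in-O? = _∈? orbit y
      Inside Outside : List X
      Inside  = filter in-O? (y ∷ Y)
      Outside = filter (∁? in-O?) (y ∷ Y)
      Inside⊆O : Inside ⊆ orbit y
      Inside⊆O p = proj₂ (∈-filter⁻ in-O? p)
      O⊆Inside : orbit y ⊆ Inside
      O⊆Inside p = ∈-filter⁺ in-O? (closed (here refl) p) p
      length-inside : length Inside ≡ K
      length-inside = trans
        (≤-antisym (Unique-⊆⇒length≤ (Unique.filter⁺ in-O? !Y) Inside⊆O)
                   (Unique-⊆⇒length≤ (orbit-unique (All.lookup gY (here refl))) O⊆Inside))
        (length-orbit y)
      length-outside : length Outside ≤ fuel
      length-outside = ≤-pred (begin
        suc (length Outside)            ≤⟨ +-monoˡ-≤ (length Outside) (∈-length (O⊆Inside orbit-refl)) ⟩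
        length Inside + length Outside  ≡⟨ length-filter-∁ in-O? (y ∷ Y) ⟨
        length (y ∷ Y)                  ≤⟨ le ⟩
        suc fuel                        ∎)
        where open ≤-Reasoning
      outside-closed : OrbitClosed Outside
      outside-closed p q with ∈-filter⁻ (∁? in-O?) p
      ... | u∈ , u∉O =
        ∈-filter⁺ (∁? in-O?) (closed u∈ q) (λ z∈O → u∉O (orbit-trans z∈O (orbit-sym q)))
      divides-outside : K ∣ length Outside
      divides-outside = go fuel Outside length-outside (Unique.filter⁺ (∁? in-O?) !Y)
        (All.tabulate λ p → All.lookup gY (proj₁ (∈-filter⁻ (∁? in-O?) p))) outside-closed

-- The orbits of y ↦ c^ε y p (ε ∈ {0,1}, p ∈ P) on G are the double cosets ⟨c⟩ y P;
-- such an orbit has 2|P| elements unless y⁻¹ c y ∈ P.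
module CosetOrbits {G : List (Map n)} (isG : IsPermGroup G)
  {P : List (Map n)} (isP : IsPermGroup P) (P⊆G : All (_∈ G) P)
  {c : Map n} (c∈G : c ∈ G) (cc : c ∘ₚ c ≡ idₚ) where
  open PermGroupProperties isG
  open PermGroupProperties isP using () renaming (inverse₂ to inverse₂ᴾ)
  module Gᵍ = IsPermGroup isG
  module Pᵍ = IsPermGroup isP
  open ≡-Reasoning

  ConjInP : Map n → Set
  ConjInP y = Any (λ r → c ∘ₚ y ≡ y ∘ₚ r) P

  ConjInP? : ∀ y → Dec (ConjInP y)
  ConjInP? y = any? (λ r → (c ∘ₚ y) ≟ₘ (y ∘ₚ r)) P

  orbit : Map n → List (Map n)
  orbit y = map (y ∘ₚ_) P ++ map (λ p → c ∘ₚ (y ∘ₚ p)) P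

  ∈-orbitˡ : ∀ y → p ∈ P → y ∘ₚ p ∈ orbit y
  ∈-orbitˡ y p∈P = ∈-++⁺ˡ (∈-map⁺ (y ∘ₚ_) p∈P)

  ∈-orbitʳ : ∀ y → p ∈ P → c ∘ₚ (y ∘ₚ p) ∈ orbit y
  ∈-orbitʳ y p∈P = ∈-++⁺ʳ (map (y ∘ₚ_) P) (∈-map⁺ (λ p → c ∘ₚ (y ∘ₚ p)) p∈P)

  ∈-orbit⁻ : w ∈ orbit y → ∃ λ p → p ∈ P × (w ≡ y ∘ₚ p ⊎ w ≡ c ∘ₚ (y ∘ₚ p))
  ∈-orbit⁻ {y = y} w∈ with ∈-++⁻ (map (y ∘ₚ_) P) w∈
  ... | inj₁ w∈ˡ = let p , p∈P , w≡ = ∈-map⁻ (y ∘ₚ_) w∈ˡ in p , p∈P , inj₁ w≡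
  ... | inj₂ w∈ʳ = let p , p∈P , w≡ = ∈-map⁻ (λ p → c ∘ₚ (y ∘ₚ p)) w∈ʳ in p , p∈P , inj₂ w≡

  length-orbit : ∀ y → length (orbit y) ≡ length P + length P
  length-orbit y = trans (length-++ (map (y ∘ₚ_) P)) (cong₂ _+_ (length-map _ P) (length-map _ P))

  orbit-refl : y ∈ orbit y
  orbit-refl {y = y} = subst (_∈ orbit y) (∘-identityʳ y) (∈-orbitˡ y Pᵍ.has-id)

  orbit-trans : u ∈ orbit y → w ∈ orbit u → w ∈ orbit y
  orbit-trans {u = u} {y = y} u∈ w∈ with ∈-orbit⁻ {y = y} u∈ | ∈-orbit⁻ {y = u} w∈
  ... | p , p∈P , inj₁ refl | q , q∈P , inj₁ refl =
    subst (_∈ orbit y) (sym (∘-assoc y p q)) (∈-orbitˡ y (Pᵍ.closed p∈P q∈P))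
  ... | p , p∈P , inj₁ refl | q , q∈P , inj₂ refl =
    subst (_∈ orbit y) (cong (c ∘ₚ_) (sym (∘-assoc y p q))) (∈-orbitʳ y (Pᵍ.closed p∈P q∈P))
  ... | p , p∈P , inj₂ refl | q , q∈P , inj₁ refl =
    subst (_∈ orbit y) (sym (trans (∘-assoc c (y ∘ₚ p) q) (cong (c ∘ₚ_) (∘-assoc y p q))))
          (∈-orbitʳ y (Pᵍ.closed p∈P q∈P))
  ... | p , p∈P , inj₂ refl | q , q∈P , inj₂ refl =
    subst (_∈ orbit y) (sym (begin
      c ∘ₚ ((c ∘ₚ (y ∘ₚ p)) ∘ₚ q)  ≡⟨ cong (c ∘ₚ_) (∘-assoc c (y ∘ₚ p) q) ⟩
      c ∘ₚ (c ∘ₚ ((y ∘ₚ p) ∘ₚ q))  ≡⟨ involution-cancelˡ {c = c} cc _ ⟩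
      (y ∘ₚ p) ∘ₚ q                ≡⟨ ∘-assoc y p q ⟩
      y ∘ₚ (p ∘ₚ q)                ∎))
      (∈-orbitˡ y (Pᵍ.closed p∈P q∈P))

  orbit-sym : w ∈ orbit y → y ∈ orbit w
  orbit-sym {y = y} w∈ with ∈-orbit⁻ {y = y} w∈
  ... | p , p∈P , inj₁ refl with inverse₂ᴾ p∈P
  ...   | p′ , p′∈P , pp′≡1 , _ = subst (_∈ orbit (y ∘ₚ p)) yp∘p′≡y (∈-orbitˡ (y ∘ₚ p) p′∈P)
    where
    yp∘p′≡y : (y ∘ₚ p) ∘ₚ p′ ≡ y
    yp∘p′≡y = trans (∘-assoc y p p′) (trans (cong (y ∘ₚ_) pp′≡1) (∘-identityʳ y))
  orbit-sym {y = y} w∈ | p , p∈P , inj₂ refl with inverse₂ᴾ p∈P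
  ...   | p′ , p′∈P , pp′≡1 , _ =
    subst (_∈ orbit (c ∘ₚ (y ∘ₚ p))) back (∈-orbitʳ (c ∘ₚ (y ∘ₚ p)) p′∈P)
    where
    back : c ∘ₚ ((c ∘ₚ (y ∘ₚ p)) ∘ₚ p′) ≡ y
    back = begin
      c ∘ₚ ((c ∘ₚ (y ∘ₚ p)) ∘ₚ p′)  ≡⟨ cong (c ∘ₚ_) (∘-assoc c (y ∘ₚ p) p′) ⟩
      c ∘ₚ (c ∘ₚ ((y ∘ₚ p) ∘ₚ p′))  ≡⟨ involution-cancelˡ {c = c} cc _ ⟩
      (y ∘ₚ p) ∘ₚ p′                ≡⟨ ∘-assoc y p p′ ⟩
      y ∘ₚ (p ∘ₚ p′)                ≡⟨ cong (y ∘ₚ_) pp′≡1 ⟩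
      y ∘ₚ idₚ                      ≡⟨ ∘-identityʳ y ⟩
      y                             ∎

  orbit-unique : y ∈ G → ¬ ConjInP y → Unique (orbit y)
  orbit-unique {y} y∈G ¬conj =
    Unique.++⁺ (Unique.map⁺ (∘-cancelˡ y∈G) Pᵍ.unique)
               (Unique.map⁺ (λ eq → ∘-cancelˡ y∈G (∘-cancelˡ c∈G eq)) Pᵍ.unique)
               disjoint
    where
    disjoint : ∀ {w} → w ∈ map (y ∘ₚ_) P × w ∈ map (λ p → c ∘ₚ (y ∘ₚ p)) P → ⊥
    disjoint (w∈ˡ , w∈ʳ) with ∈-map⁻ (y ∘ₚ_) w∈ˡ | ∈-map⁻ (λ p → c ∘ₚ (y ∘ₚ p)) w∈ʳ
    ... | p , p∈P , refl | q , q∈P , yp≡cyq with inverse₂ᴾ p∈P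
    ... | p′ , p′∈P , pp′≡1 , _ = ¬conj (lose (Pᵍ.closed q∈P p′∈P) (begin
      c ∘ₚ y                        ≡⟨ ∘-identityʳ (c ∘ₚ y) ⟨
      (c ∘ₚ y) ∘ₚ idₚ               ≡⟨ cong ((c ∘ₚ y) ∘ₚ_) pp′≡1 ⟨
      (c ∘ₚ y) ∘ₚ (p ∘ₚ p′)         ≡⟨ ∘-assoc (c ∘ₚ y) p p′ ⟨
      ((c ∘ₚ y) ∘ₚ p) ∘ₚ p′         ≡⟨ cong (_∘ₚ p′) (∘-assoc c y p) ⟩
      (c ∘ₚ (y ∘ₚ p)) ∘ₚ p′         ≡⟨ cong (λ t → (c ∘ₚ t) ∘ₚ p′) yp≡cyq ⟩
      (c ∘ₚ (c ∘ₚ (y ∘ₚ q))) ∘ₚ p′  ≡⟨ cong (_∘ₚ p′) (involution-cancelˡ {c = c} cc (y ∘ₚ q)) ⟩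
      (y ∘ₚ q) ∘ₚ p′                ≡⟨ ∘-assoc y q p′ ⟩
      y ∘ₚ (q ∘ₚ p′)                ∎))

  ConjInP-∘ʳ : ConjInP y → p ∈ P → ConjInP (y ∘ₚ p)
  ConjInP-∘ʳ {y} {p} conj p∈P with find conj | inverse₂ᴾ p∈P
  ... | r , r∈P , cy≡yr | p′ , p′∈P , pp′≡1 , _ = lose (Pᵍ.closed p′∈P (Pᵍ.closed r∈P p∈P)) (begin
    c ∘ₚ (y ∘ₚ p)                  ≡⟨ ∘-assoc c y p ⟨
    (c ∘ₚ y) ∘ₚ p                  ≡⟨ cong (_∘ₚ p) cy≡yr ⟩
    (y ∘ₚ r) ∘ₚ p                  ≡⟨ ∘-assoc y r p ⟩
    y ∘ₚ (r ∘ₚ p)                  ≡⟨ cong (y ∘ₚ_) (∘-identityˡ (r ∘ₚ p)) ⟨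
    y ∘ₚ (idₚ ∘ₚ (r ∘ₚ p))         ≡⟨ cong (λ t → y ∘ₚ (t ∘ₚ (r ∘ₚ p))) pp′≡1 ⟨
    y ∘ₚ ((p ∘ₚ p′) ∘ₚ (r ∘ₚ p))   ≡⟨ cong (y ∘ₚ_) (∘-assoc p p′ (r ∘ₚ p)) ⟩
    y ∘ₚ (p ∘ₚ (p′ ∘ₚ (r ∘ₚ p)))   ≡⟨ ∘-assoc y p (p′ ∘ₚ (r ∘ₚ p)) ⟨
    (y ∘ₚ p) ∘ₚ (p′ ∘ₚ (r ∘ₚ p))   ∎)

  ConjInP-c∘ : ConjInP y → ConjInP (c ∘ₚ y)
  ConjInP-c∘ {y} conj with find conj
  ... | r , r∈P , cy≡yr with inverse₂ᴾ r∈P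
  ... | r′ , r′∈P , rr′≡1 , _ = lose r′∈P (begin
    c ∘ₚ (c ∘ₚ y)     ≡⟨ involution-cancelˡ {c = c} cc y ⟩
    y                 ≡⟨ ∘-identityʳ y ⟨
    y ∘ₚ idₚ          ≡⟨ cong (y ∘ₚ_) rr′≡1 ⟨
    y ∘ₚ (r ∘ₚ r′)    ≡⟨ ∘-assoc y r r′ ⟨
    (y ∘ₚ r) ∘ₚ r′    ≡⟨ cong (_∘ₚ r′) cy≡yr ⟨
    (c ∘ₚ y) ∘ₚ r′    ∎)

  ConjInP-orbit : w ∈ orbit y → ConjInP y → ConjInP w
  ConjInP-orbit {y = y} w∈ conj with ∈-orbit⁻ {y = y} w∈
  ... | p , p∈P , inj₁ refl = ConjInP-∘ʳ {y = y} conj p∈P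
  ... | p , p∈P , inj₂ refl = ConjInP-c∘ {y = y ∘ₚ p} (ConjInP-∘ʳ {y = y} conj p∈P)

  ConjInP-commuting : ∀ d → d ∘ₚ c ≡ c ∘ₚ d → ConjInP y → ConjInP (d ∘ₚ y)
  ConjInP-commuting {y} d dc≡cd conj with find conj
  ... | r , r∈P , cy≡yr = lose r∈P (begin
    c ∘ₚ (d ∘ₚ y)    ≡⟨ ∘-assoc c d y ⟨
    (c ∘ₚ d) ∘ₚ y    ≡⟨ cong (_∘ₚ y) dc≡cd ⟨
    (d ∘ₚ c) ∘ₚ y    ≡⟨ ∘-assoc d c y ⟩
    d ∘ₚ (c ∘ₚ y)    ≡⟨ cong (d ∘ₚ_) cy≡yr ⟩
    d ∘ₚ (y ∘ₚ r)    ≡⟨ ∘-assoc d y r ⟨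
    (d ∘ₚ y) ∘ₚ r    ∎)

  orbit⊆G : y ∈ G → orbit y ⊆ G
  orbit⊆G {y} y∈G w∈ with ∈-orbit⁻ {y = y} w∈
  ... | p , p∈P , inj₁ refl = Gᵍ.closed y∈G (All.lookup P⊆G p∈P)
  ... | p , p∈P , inj₂ refl = Gᵍ.closed c∈G (Gᵍ.closed y∈G (All.lookup P⊆G p∈P))

  open OrbitCounting _≟ₘ_ orbit (λ y → y ∈ G × ¬ ConjInP y) (length P + length P)
    (λ (y∈G , ¬conj) → orbit-unique y∈G ¬conj) length-orbit
    (λ {y} → orbit-refl {y = y}) (λ {y} {u} {w} → orbit-trans {u = u} {y = y} {w = w})
    (λ {y} {w} → orbit-sym {w = w} {y = y})
    public using (OrbitClosed; orbit-size-∣-length)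

  double-∣P∣-∣-nonConj : ∀ {Y} → Unique Y → All (_∈ G) Y → OrbitClosed Y →
                         length P + length P ∣ length (filter (∁? ConjInP?) Y)
  double-∣P∣-∣-nonConj !Y Y⊆G closed = orbit-size-∣-length
    (Unique.filter⁺ (∁? ConjInP?) !Y)
    (All.tabulate λ y∈ →
      let y∈Y , ¬conj = ∈-filter⁻ (∁? ConjInP?) y∈ in All.lookup Y⊆G y∈Y , ¬conj)
    λ {y} {z} y∈ z∈ → let y∈Y , ¬conj = ∈-filter⁻ (∁? ConjInP?) y∈ in
      ∈-filter⁺ (∁? ConjInP?) (closed y∈Y z∈)
                (¬conj ∘ ConjInP-orbit {y = z} (orbit-sym {y = y} z∈))

KleinFour : Map n → Map n → Set
KleinFour a b = DistinctInvolutions a b × b ∘ₚ a ≡ a ∘ₚ b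

-- No y conjugates both a and b into P, as the cyclic P has only one involution. So G splits
-- into the y with y⁻¹ay ∉ P, a union of double cosets ⟨a⟩yP of size 2|P|, and the y with
-- y⁻¹ay ∈ P but y⁻¹by ∉ P, a union of double cosets ⟨b⟩yP (as b commutes with a); hence
-- 2|P| = 2^(k+1) divides |G|.
cyclicSylow2⇒¬KleinFour : ∀ {G : List (Map n)} → IsPermGroup G → HasCyclicSylow2 G →
                          a ∈ G → b ∈ G → ¬ KleinFour a b
cyclicSylow2⇒¬KleinFour {n = n} {a = a} {b} {G} isG
  (P , ((P⊆G , isP) , k , ∣P∣≡2^k , _ , 2^[k+1]∤∣G∣) , cyclicP)
  a∈G b∈G ((a≢1 , b≢1 , a≢b , aa , bb) , ba≡ab) =
  2^[k+1]∤∣G∣ (subst (_∣ length G) double-∣P∣≡2^[k+1] double-∣P∣-∣-∣G∣)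
  where
  open IsPermGroup isG
  open PermGroupProperties isG
  module A = CosetOrbits isG isP P⊆G a∈G aa
  module B = CosetOrbits isG isP P⊆G b∈G bb

  Gᴬ : List (Map n)
  Gᴬ = filter A.ConjInP? G

  ¬ConjInP-both : ∀ {x} → x ∈ G → A.ConjInP x → ¬ B.ConjInP x
  ¬ConjInP-both {x} x∈G conjA conjB with find conjA | find conjB
  ... | p , p∈P , ax≡xp | q , q∈P , bx≡xq = cyclic⇒¬DistinctInvolutions cyclicP p∈P q∈P
    ( conjugate-nonId x∈G a≢1 ax≡xp , conjugate-nonId x∈G b≢1 bx≡xq , p≢q
    , conjugate-involution {c = a} {r = p} x∈G aa ax≡xp
    , conjugate-involution {c = b} {r = q} x∈G bb bx≡xq )
    where
    p≢q : p ≢ q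
    p≢q refl = a≢b (∘-cancelʳ x∈G (trans ax≡xp (sym bx≡xq)))

  Gᴬ∖B≡Gᴬ : filter (∁? B.ConjInP?) Gᴬ ≡ Gᴬ
  Gᴬ∖B≡Gᴬ = filter-all (∁? B.ConjInP?) (All.tabulate λ x∈ →
    let x∈G , conjA = ∈-filter⁻ A.ConjInP? x∈ in ¬ConjInP-both x∈G conjA)

  G-closedᴬ : A.OrbitClosed G
  G-closedᴬ y∈G = A.orbit⊆G y∈G

  Gᴬ-closedᴮ : B.OrbitClosed Gᴬ
  Gᴬ-closedᴮ {y} {z} y∈ z∈ with ∈-filter⁻ A.ConjInP? y∈ | B.∈-orbit⁻ {y = y} z∈
  ... | y∈G , conjA | p , p∈P , inj₁ refl =
    ∈-filter⁺ A.ConjInP? (B.orbit⊆G y∈G z∈) (A.ConjInP-∘ʳ {y = y} conjA p∈P)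
  ... | y∈G , conjA | p , p∈P , inj₂ refl =
    ∈-filter⁺ A.ConjInP? (B.orbit⊆G y∈G z∈)
              (A.ConjInP-commuting {y = y ∘ₚ p} b ba≡ab (A.ConjInP-∘ʳ {y = y} conjA p∈P))

  double-∣P∣-∣-∣G∣ : length P + length P ∣ length G
  double-∣P∣-∣-∣G∣ = subst (length P + length P ∣_) (sym (length-filter-∁ A.ConjInP? G))
    (∣m∣n⇒∣m+n
      (subst (λ Y → length P + length P ∣ length Y) Gᴬ∖B≡Gᴬ
             (B.double-∣P∣-∣-nonConj (Unique.filter⁺ A.ConjInP? unique)
                                     (All.tabulate (proj₁ ∘ ∈-filter⁻ A.ConjInP?)) Gᴬ-closedᴮ))
      (A.double-∣P∣-∣-nonConj unique (All.tabulate id) G-closedᴬ))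

  double-∣P∣≡2^[k+1] : length P + length P ≡ 2 ^ suc k
  double-∣P∣≡2^[k+1] =
    trans (cong₂ _+_ ∣P∣≡2^k ∣P∣≡2^k) (cong (2 ^ k +_) (sym (+-identityʳ (2 ^ k))))

module OrderTwoStabilizers {G : List (Map n)} (isG : IsPermGroup G)
  (∣Gᵥ∣≡2 : (v : Fin n) → length (stab G v) ≡ 2) where
  open IsPermGroup isG
  open PermGroupProperties isG
  open ≡-Reasoning

  NonIdStabAt : Fin n → Map n → Set
  NonIdStabAt v a = a ∈ G × lookup a v ≡ v × a ≢ idₚ

  NonIdStab : Map n → Set
  NonIdStab a = ∃ λ v → NonIdStabAt v a

  NonIdStabAt-unique : ∀ {v} → NonIdStabAt v a → NonIdStabAt v b → a ≡ b
  NonIdStabAt-unique {a} {b} {v} (a∈G , av≡v , a≢1) (b∈G , bv≡v , b≢1) with a ≟ₘ b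
  ... | yes a≡b = a≡b
  ... | no  a≢b = ⊥-elim (<-irrefl refl (subst (3 ≤_) (∣Gᵥ∣≡2 v) (Unique-⊆⇒length≤ !1ab 1ab⊆Gᵥ)))
    where
    !1ab : Unique (idₚ ∷ a ∷ b ∷ [])
    !1ab = (a≢1 ∘ sym ∷ b≢1 ∘ sym ∷ []) ∷ (a≢b ∷ []) ∷ [] ∷ []
    ∈-stab : ∀ {g} → g ∈ G → lookup g v ≡ v → g ∈ stab G v
    ∈-stab = ∈-filter⁺ (λ g → lookup g v Fin.≟ v)
    1ab⊆Gᵥ : idₚ ∷ a ∷ b ∷ [] ⊆ stab G v
    1ab⊆Gᵥ (here refl)                = ∈-stab has-id (lookup-id v)
    1ab⊆Gᵥ (there (here refl))        = ∈-stab a∈G av≡v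
    1ab⊆Gᵥ (there (there (here refl))) = ∈-stab b∈G bv≡v

  NonIdStab⇒involution : NonIdStab a → a ∘ₚ a ≡ idₚ
  NonIdStab⇒involution {a} (v , a∈G , av≡v , a≢1) with (a ∘ₚ a) ≟ₘ idₚ
  ... | yes aa≡1 = aa≡1
  ... | no  aa≢1 = ⊥-elim (a≢1 (∘-cancelˡ a∈G (trans aa≡a (sym (∘-identityʳ a)))))
    where
    aa≡a : a ∘ₚ a ≡ a
    aa≡a = NonIdStabAt-unique
      (closed a∈G a∈G , trans (lookup-∘ a a v) (trans (cong (lookup a) av≡v) av≡v) , aa≢1)
      (a∈G , av≡v , a≢1)

  StabTriple : Map n → Map n → Set
  StabTriple a b = NonIdStab a × NonIdStab b × NonIdStab (a ∘ₚ b)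

  StabTriple⇒KleinFour : StabTriple a b → KleinFour a b
  StabTriple⇒KleinFour {a} {b}
    (a∈S@(_ , _ , _ , a≢1) , b∈S@(_ , _ , _ , b≢1) , ab∈S@(_ , _ , _ , ab≢1)) =
    (a≢1 , b≢1 , a≢b , aa , bb) , involutions-commute {a = a} {b} aa bb (NonIdStab⇒involution ab∈S)
    where
    aa : a ∘ₚ a ≡ idₚ
    aa = NonIdStab⇒involution a∈S
    bb : b ∘ₚ b ≡ idₚ
    bb = NonIdStab⇒involution b∈S
    a≢b : a ≢ b
    a≢b refl = ab≢1 aa

  -- σ = f₁⁻¹f₂ and τ = f₁⁻¹f₃ fix the points where f₁ agrees with f₂, f₃; as σ = σ⁻¹,
  -- στ = f₂⁻¹f₃ fixes the point where f₂ and f₃ agree.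
  large-intersecting⇒StabTriple : ∀ {F} → Intersecting G F → 3 ≤ length F →
                                   ∃ λ a → ∃ λ b → StabTriple a b
  large-intersecting⇒StabTriple {f₁ ∷ f₂ ∷ f₃ ∷ _}
    (f₁∈G ∷ f₂∈G ∷ f₃∈G ∷ _ , (f₁≢f₂ ∷ f₁≢f₃ ∷ _) ∷ (f₂≢f₃ ∷ _) ∷ _ , agree) (s≤s (s≤s (s≤s _)))
    with inverse₂ f₁∈G
  ... | h , h∈G , _ , hf₁≡1 = σ , τ , σ∈S , τ∈S , στ∈S
    where
    σ τ : Map n
    σ = h ∘ₚ f₂
    τ = h ∘ₚ f₃
    translate-fixes : ∀ {f v} → lookup f₁ v ≡ lookup f v → lookup (h ∘ₚ f) v ≡ v
    translate-fixes {f} {v} f₁v≡fv = begin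
      lookup (h ∘ₚ f) v       ≡⟨ lookup-∘ h f v ⟩
      lookup h (lookup f v)   ≡⟨ cong (lookup h) f₁v≡fv ⟨
      lookup h (lookup f₁ v)  ≡⟨ lookup-∘ h f₁ v ⟨
      lookup (h ∘ₚ f₁) v      ≡⟨ cong (λ t → lookup t v) hf₁≡1 ⟩
      lookup idₚ v            ≡⟨ lookup-id v ⟩
      v                       ∎
    translate-nonId : ∀ {f} → f₁ ≢ f → h ∘ₚ f ≢ idₚ
    translate-nonId f₁≢f hf≡1 = f₁≢f (∘-cancelˡ h∈G (trans hf₁≡1 (sym hf≡1)))
    σ∈S : NonIdStab σ
    σ∈S = let v , f₁v≡f₂v = agree (here refl) (there (here refl)) in
      v , closed h∈G f₂∈G , translate-fixes {f₂} f₁v≡f₂v , translate-nonId f₁≢f₂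
    τ∈S : NonIdStab τ
    τ∈S = let v , f₁v≡f₃v = agree (here refl) (there (there (here refl))) in
      v , closed h∈G f₃∈G , translate-fixes {f₃} f₁v≡f₃v , translate-nonId f₁≢f₃
    σσ : σ ∘ₚ σ ≡ idₚ
    σσ = NonIdStab⇒involution σ∈S
    στ-fixes : ∀ {u} → lookup f₂ u ≡ lookup f₃ u → lookup (σ ∘ₚ τ) u ≡ u
    στ-fixes {u} f₂u≡f₃u = begin
      lookup (σ ∘ₚ τ) u                  ≡⟨ lookup-∘ σ τ u ⟩
      lookup σ (lookup τ u)              ≡⟨ cong (lookup σ) (lookup-∘ h f₃ u) ⟩
      lookup σ (lookup h (lookup f₃ u))  ≡⟨ cong (λ t → lookup σ (lookup h t)) f₂u≡f₃u ⟨
      lookup σ (lookup h (lookup f₂ u))  ≡⟨ cong (lookup σ) (lookup-∘ h f₂ u) ⟨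
      lookup σ (lookup σ u)              ≡⟨ lookup-∘ σ σ u ⟨
      lookup (σ ∘ₚ σ) u                  ≡⟨ cong (λ t → lookup t u) σσ ⟩
      lookup idₚ u                       ≡⟨ lookup-id u ⟩
      u                                  ∎
    στ≢1 : σ ∘ₚ τ ≢ idₚ
    στ≢1 στ≡1 = f₂≢f₃ (sym (∘-cancelˡ h∈G (begin
      τ               ≡⟨ involution-cancelˡ {c = σ} σσ τ ⟨
      σ ∘ₚ (σ ∘ₚ τ)   ≡⟨ cong (σ ∘ₚ_) στ≡1 ⟩
      σ ∘ₚ idₚ        ≡⟨ ∘-identityʳ σ ⟩
      σ               ∎)))
    στ∈S : NonIdStab (σ ∘ₚ τ)
    στ∈S = let u , f₂u≡f₃u = agree (there (here refl)) (there (there (here refl))) in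
      u , closed (closed h∈G f₂∈G) (closed h∈G f₃∈G) , στ-fixes f₂u≡f₃u , στ≢1

  UpperCentral⇒∈ : ∀ i {z} → UpperCentral G i z → z ∈ G
  UpperCentral⇒∈ zero    refl      = has-id
  UpperCentral⇒∈ (suc i) (z∈G , _) = z∈G

  -- With x moving the fixed point of b to that of a, the commutator z = [a, x] ∈ Zᵢ
  -- satisfies a z = x⁻¹ a x ∈ G_w ∖ {1}, hence a z = b and z = a b.
  StabTriple-descend : Transitive G → ∀ {i} → StabTriple a b → UpperCentral G (suc i) a →
                       ∃ λ z → UpperCentral G i z × StabTriple z b
  StabTriple-descend {a} {b} transitive {i}
    (a∈S@(v , a∈G , av≡v , a≢1) , b∈S@(w , b∈G , bw≡w , b≢1) , ab∈S) (_ , central)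
    with transitive w v
  ... | x , x∈G , xw≡v with central x∈G
  ... | z , z∈Zᵢ , ax≡x[az] =
    z , z∈Zᵢ , subst NonIdStab (sym z≡ab) ab∈S , b∈S , subst NonIdStab (sym zb≡a) a∈S
    where
    az-fixes : lookup (a ∘ₚ z) w ≡ w
    az-fixes = lookup-injective x∈G (begin
      lookup x (lookup (a ∘ₚ z) w)  ≡⟨ lookup-∘ x (a ∘ₚ z) w ⟨
      lookup (x ∘ₚ (a ∘ₚ z)) w      ≡⟨ cong (λ t → lookup t w) ax≡x[az] ⟨
      lookup (a ∘ₚ x) w             ≡⟨ lookup-∘ a x w ⟩
      lookup a (lookup x w)         ≡⟨ cong (lookup a) xw≡v ⟩
      lookup a v                    ≡⟨ av≡v ⟩
      v                             ≡⟨ xw≡v ⟨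
      lookup x w                    ∎)
    az≢1 : a ∘ₚ z ≢ idₚ
    az≢1 az≡1 = a≢1 (∘-cancelʳ x∈G (begin
      a ∘ₚ x          ≡⟨ ax≡x[az] ⟩
      x ∘ₚ (a ∘ₚ z)   ≡⟨ cong (x ∘ₚ_) az≡1 ⟩
      x ∘ₚ idₚ        ≡⟨ ∘-identityʳ x ⟩
      x               ≡⟨ ∘-identityˡ x ⟨
      idₚ ∘ₚ x        ∎))
    az≡b : a ∘ₚ z ≡ b
    az≡b = NonIdStabAt-unique (closed a∈G (UpperCentral⇒∈ i z∈Zᵢ) , az-fixes , az≢1)
                              (b∈G , bw≡w , b≢1)
    aa : a ∘ₚ a ≡ idₚ
    aa = NonIdStab⇒involution a∈S
    z≡ab : z ≡ a ∘ₚ b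
    z≡ab = trans (sym (involution-cancelˡ {c = a} aa z)) (cong (a ∘ₚ_) az≡b)
    zb≡a : z ∘ₚ b ≡ a
    zb≡a = begin
      z ∘ₚ b          ≡⟨ cong (_∘ₚ b) z≡ab ⟩
      (a ∘ₚ b) ∘ₚ b   ≡⟨ ∘-assoc a b b ⟩
      a ∘ₚ (b ∘ₚ b)   ≡⟨ cong (a ∘ₚ_) (NonIdStab⇒involution b∈S) ⟩
      a ∘ₚ idₚ        ≡⟨ ∘-identityʳ a ⟩
      a               ∎

  UpperCentral⇒¬StabTriple : Transitive G → ∀ i → UpperCentral G i a → ¬ StabTriple a b
  UpperCentral⇒¬StabTriple _          zero    a≡1  ((_ , _ , _ , a≢1) , _) = a≢1 a≡1
  UpperCentral⇒¬StabTriple transitive (suc i) a∈Z triple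
    with StabTriple-descend transitive triple a∈Z
  ... | z , z∈Zᵢ , triple′ = UpperCentral⇒¬StabTriple transitive i z∈Zᵢ triple′

  ¬StabTriple⇒intersecting≤2 : (∀ {a b} → ¬ StabTriple a b) →
                               ∀ {F} → Intersecting G F → length F ≤ 2
  ¬StabTriple⇒intersecting≤2 no-triple {F} F-int with length F ≤? 2
  ... | yes ∣F∣≤2 = ∣F∣≤2
  ... | no  ∣F∣≰2 with large-intersecting⇒StabTriple F-int (≰⇒> ∣F∣≰2)
  ...   | _ , _ , triple = ⊥-elim (no-triple triple)

  cyclicSylow2⊎nilpotent⇒¬StabTriple : Transitive G → HasCyclicSylow2 G ⊎ IsNilpotent G →
                                        ¬ StabTriple a b
  cyclicSylow2⊎nilpotent⇒¬StabTriple _ (inj₁ cyclicSylow2)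
    triple@((_ , a∈G , _) , (_ , b∈G , _) , _) =
    cyclicSylow2⇒¬KleinFour isG cyclicSylow2 a∈G b∈G (StabTriple⇒KleinFour triple)
  cyclicSylow2⊎nilpotent⇒¬StabTriple transitive (inj₂ (c , G⊆Zc))
    triple@((_ , a∈G , _) , _) =
    UpperCentral⇒¬StabTriple transitive c (All.lookup G⊆Zc a∈G) triple

stab-intersecting : ∀ {G : List (Map n)} → Unique G → ∀ v → Intersecting G (stab G v)
stab-intersecting {n} {G} !G v =
  All.tabulate (proj₁ ∘ ∈-filter⁻ fixes-v? {xs = G}) , Unique.filter⁺ fixes-v? !G ,
  λ g∈ h∈ → v , trans (proj₂ (∈-filter⁻ fixes-v? {xs = G} g∈))
                      (sym (proj₂ (∈-filter⁻ fixes-v? {xs = G} h∈)))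
  where
  fixes-v? : (g : Map n) → Dec (lookup g v ≡ v)
  fixes-v? g = lookup g v Fin.≟ v

foldr-⊔-≤ : ∀ {k} {ns : List ℕ} → All (_≤ k) ns → foldr _⊔_ 0 ns ≤ k
foldr-⊔-≤ []            = z≤n
foldr-⊔-≤ (m≤k ∷ ns≤k) = ⊔-lub m≤k (foldr-⊔-≤ ns≤k)

maxStab-const : ∀ {m} k (G : List (Map (suc m))) → (∀ v → length (stab G v) ≡ k) → maxStab G ≡ k
maxStab-const {m} k G ∣Gᵥ∣≡k =
  trans (cong (_⊔ foldr _⊔_ 0 others) (∣Gᵥ∣≡k fzero)) (m≥n⇒m⊔n≡m (foldr-⊔-≤ others≤k))
  where
  others : List ℕ
  others = map (λ v → length (stab G v)) (tabulate {n = m} fsuc)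
  others≤k : All (_≤ k) others
  others≤k = All.tabulate λ ∣Gᵥ∣∈ →
    let v , _ , ≡∣Gᵥ∣ = ∈-map⁻ (λ v → length (stab G v)) ∣Gᵥ∣∈ in
    ≤-reflexive (trans ≡∣Gᵥ∣ (∣Gᵥ∣≡k v))

Intersecting-Fin0⇒length≤0 : ∀ {G F : List (Map 0)} → Intersecting G F → length F ≤ 0
Intersecting-Fin0⇒length≤0 {F = []}    _                = z≤n
Intersecting-Fin0⇒length≤0 {F = _ ∷ _} (_ , _ , agree) with agree (here refl) (here refl)
... | () , _

proposition3p2 : (n : ℕ) (G : List (Map n)) → IsPermGroup G → Transitive G →
    ((v : Fin n) → length (stab G v) ≡ 2) →
    (HasCyclicSylow2 G ⊎ IsNilpotent G) → EKR G
proposition3p2 zero    G _   _          _      _   =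
  ([] , ([] , [] , λ ()) , refl) , λ _ → Intersecting-Fin0⇒length≤0
proposition3p2 (suc m) G isG transitive ∣Gᵥ∣≡2 hyp =
  (stab G fzero , stab-intersecting unique fzero , trans (∣Gᵥ∣≡2 fzero) (sym maxStab≡2)) ,
  λ F F-int → subst (length F ≤_) (sym maxStab≡2) (¬StabTriple⇒intersecting≤2 no-triple F-int)
  where
  open IsPermGroup isG using (unique)
  open OrderTwoStabilizers isG ∣Gᵥ∣≡2
  maxStab≡2 : maxStab G ≡ 2
  maxStab≡2 = maxStab-const 2 G ∣Gᵥ∣≡2
  no-triple : ∀ {a b} → ¬ StabTriple a b
  no-triple = cyclicSylow2⊎nilpotent⇒¬StabTriple transitive hyp
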